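{- Let $s\ge 1$ be an integer, let $M=c\begin{pmatrix} a & b\\ 0 & 1\end{pmatrix}$ with $a,b,c\in\mathbb{Q}$, and for $i=1,\ldots,s+1$ let $N_i=\begin{pmatrix} A_i & B_i\\ 0 & C_i\end{pmatrix}$ with $A_i,B_i,C_i\in\mathbb{Q}$. Then one can compute (from $a,b,c,A_i,B_i,C_i$) rational numbers $q_1,\ldots,q_{s+1},p_1,\ldots,p_s$ such that for all positive integers $m_1,\ldots,m_s$, \[N_1M^{m_1}N_2\cdots N_sM^{m_s}N_{s+1}=c^{m_1+\cdots+m_s}\begin{pmatrix} A_1\cdots A_{s+1}\,a^{m_1+\cdots+m_s} & \mathrm{val}_a(w)\\ 0 & C_1\cdots C_{s+1}\end{pmatrix},\] where $w$ is the word $w=\overline{q_1}\,\overline{p_1}^{\,m_s-1}\,\overline{q_2}\,\overline{p_2}^{\,m_{s-1}-1}\cdots\overline{q_s}\,\overline{p_s}^{\,m_1-1}\,\overline{q_{s+1}}$.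
   Context: For each rational number $m$ there is a digit (letter) $\overline{m}$ whose value is $m$. For a rational base $r$ and a word $w=w_{n-1}\cdots w_1w_0$ over such digits (where $w_i$ has value, also denoted $w_i$), $\mathrm{val}_r(w)=\sum_{i=0}^{n-1}w_i r^i$ (with $r^0=1$); thus the leftmost digit carries the highest power of $r$. $\overline{p}^{\,k}$ denotes the word consisting of $k$ copies of the digit $\overline{p}$. -}

module Defs where

open import Data.Nat as ℕ using (ℕ; zero; suc)
open import Data.Fin using (Fin; zero; suc; fromℕ; inject₁)
open import Data.List using (List; []; _∷_; _++_; replicate; reverse)
open import Data.Rational using (ℚ; 0ℚ; 1ℚ; _+_; _*_)

infixr 8 _^ᵣ_
_^ᵣ_ : ℚ → ℕ → ℚ
r ^ᵣ zero = 1ℚ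
r ^ᵣ suc n = r * (r ^ᵣ n)

record Mat : Set where
  constructor mat
  field
    e00 e01 e10 e11 : ℚ

infixl 7 _⊗_
_⊗_ : Mat → Mat → Mat
mat a b c d ⊗ mat a' b' c' d' =
  mat (a * a' + b * c') (a * b' + b * d') (c * a' + d * c') (c * b' + d * d')

idM : Mat
idM = mat 1ℚ 0ℚ 0ℚ 1ℚ

_·_ : ℚ → Mat → Mat
k · mat a b c d = mat (k * a) (k * b) (k * c) (k * d)

_^M_ : Mat → ℕ → Mat
X ^M zero = idM
X ^M suc n = X ⊗ (X ^M n)

upper : ℚ → ℚ → ℚ → Mat
upper x y z = mat x y 0ℚ z

-- val_r(w) = Σ w_i r^i where w_0 is the RIGHTMOST digit
valRev : ℚ → List ℚ → ℚ
valRev r [] = 0ℚ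
valRev r (d ∷ ds) = d + r * valRev r ds

val : ℚ → List ℚ → ℚ
val r w = valRev r (reverse w)

sumℕ : (n : ℕ) → (Fin n → ℕ) → ℕ
sumℕ zero f = 0
sumℕ (suc n) f = f zero ℕ.+ sumℕ n (λ i → f (suc i))

prodℚ : (n : ℕ) → (Fin n → ℚ) → ℚ
prodℚ zero f = 1ℚ
prodℚ (suc n) f = f zero * prodℚ n (λ i → f (suc i))

-- N_1 M^{m_1} N_2 ⋯ N_s M^{m_s} N_{s+1}   (indices 0-based here)
chain : (s : ℕ) → Mat → (Fin (suc s) → Mat) → (Fin s → ℕ) → Mat
chain zero M N m = N zero
chain (suc s) M N m = N zero ⊗ (M ^M m zero) ⊗ chain s M (λ i → N (suc i)) (λ i → m (suc i))

-- w = q_1 p_1^{m_s - 1} q_2 p_2^{m_{s-1} - 1} ⋯ q_s p_s^{m_1 - 1} q_{s+1}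
-- (0-based: q i, p i; p i repeated (m_{s-1-i} - 1) times)
word : (s : ℕ) → (Fin (suc s) → ℚ) → (Fin s → ℚ) → (Fin s → ℕ) → List ℚ
word zero q p m = q zero ∷ []
word (suc s) q p m =
  q zero ∷ (replicate (m (fromℕ s) ℕ.∸ 1) (p zero)
    ++ word s (λ i → q (suc i)) (λ i → p (suc i)) (λ i → m (inject₁ i)))

-- Upper-triangular matrices multiply by
--   [[x, y], [0, z]]·[[x', y'], [0, z']] = [[x x', x y' + y z'], [0, z z']],
-- so the diagonal of the product is a pair of plain products, and only the
-- upper-right entry needs work.  Writing that entry in base a, each factor M^k
-- (whose upper-right entry is val_a(b^k) = b(1 + a + ⋯ + a^{k-1})) contributes
-- a block of k equal digits, and each N_i one extra digit.  We construct the
-- digits q, p explicitly by recursion on s, appending one factor M^k N on the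
-- right at each step; the word w then grows by a new leading digit q₁ and k-1
-- copies of a new p₁, while the old digits get multiplied by C of the new
-- factor (and the old leading digit absorbs one carry).
module Submission where

open import Defs
open import Data.Nat using (ℕ; suc; _≤_)
open import Data.Fin using (Fin)
open import Data.Product using (Σ)
open import Data.Rational using (ℚ; 1ℚ; _*_)
open import Relation.Binary.PropositionalEquality using (_≡_)

open import Data.Nat as ℕ using (zero; _∸_; >-nonZero)
import Data.Nat.Properties as ℕP
open import Data.Fin using (zero; suc; fromℕ; inject₁)
open import Data.List using (List; []; _∷_; _++_; replicate; reverse; length; map; [_])
import Data.List.Properties as LP
open import Data.Rational using (0ℚ; _+_)
import Data.Rational.Properties as QP
open import Data.Rational.Solver using (module +-*-Solver)
open +-*-Solver using (solve; _:+_; _:*_; _:=_; con)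
open import Relation.Binary.PropositionalEquality using (refl; sym; trans; cong; cong₂; module ≡-Reasoning)
open import Data.Product using (_,_)

init : {X : Set} {n : ℕ} → (Fin (suc n) → X) → Fin n → X
init f i = f (inject₁ i)

last : {X : Set} {n : ℕ} → (Fin (suc n) → X) → X
last {n = n} f = f (fromℕ n)

mat-cong : ∀ {a b c d a' b' c' d'} → a ≡ a' → b ≡ b' → c ≡ c' → d ≡ d' →
           mat a b c d ≡ mat a' b' c' d'
mat-cong refl refl refl refl = refl

·upper-cong : ∀ {k k' x x' y y' z z'} → k ≡ k' → x ≡ x' → y ≡ y' → z ≡ z' →
              k · upper x y z ≡ k' · upper x' y' z'
·upper-cong refl refl refl refl = refl

⊗-assoc : ∀ X Y Z → X ⊗ (Y ⊗ Z) ≡ X ⊗ Y ⊗ Z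
⊗-assoc (mat a b c d) (mat e f g h) (mat i j k l) =
  mat-cong (entry a b e f g h i k) (entry a b e f g h j l)
           (entry c d e f g h i k) (entry c d e f g h j l)
  where
  entry : ∀ x y e f g h i k →
          x * (e * i + f * k) + y * (g * i + h * k) ≡ (x * e + y * g) * i + (x * f + y * h) * k
  entry = solve 8 (λ x y e f g h i k →
    x :* (e :* i :+ f :* k) :+ y :* (g :* i :+ h :* k) := (x :* e :+ y :* g) :* i :+ (x :* f :+ y :* h) :* k) refl

·-⊗ : ∀ k X Y → (k · X) ⊗ Y ≡ k · (X ⊗ Y)
·-⊗ k (mat a b c d) (mat a' b' c' d') =
  mat-cong (entry a a' b c') (entry a b' b d') (entry c a' d c') (entry c b' d d')
  where
  entry : ∀ x y z w → (k * x) * y + (k * z) * w ≡ k * (x * y + z * w)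
  entry = solve 5 (λ k x y z w → (k :* x) :* y :+ (k :* z) :* w := k :* (x :* y :+ z :* w)) refl k

⊗-· : ∀ k X Y → X ⊗ (k · Y) ≡ k · (X ⊗ Y)
⊗-· k (mat a b c d) (mat a' b' c' d') =
  mat-cong (entry a a' b c') (entry a b' b d') (entry c a' d c') (entry c b' d d')
  where
  entry : ∀ x y z w → x * (k * y) + z * (k * w) ≡ k * (x * y + z * w)
  entry = solve 5 (λ k x y z w → x :* (k :* y) :+ z :* (k :* w) := k :* (x :* y :+ z :* w)) refl k

·-· : ∀ k l X → k · (l · X) ≡ (k * l) · X
·-· k l (mat a b c d) = mat-cong (entry a) (entry b) (entry c) (entry d)
  where
  entry : ∀ x → k * (l * x) ≡ (k * l) * x
  entry x = sym (QP.*-assoc k l x)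

scalar-⊗ : ∀ k l X Y → (k · X) ⊗ (l · Y) ≡ (k * l) · (X ⊗ Y)
scalar-⊗ k l X Y = begin
  (k · X) ⊗ (l · Y)   ≡⟨ ·-⊗ k X (l · Y) ⟩
  k · (X ⊗ (l · Y))   ≡⟨ cong (k ·_) (⊗-· l X Y) ⟩
  k · (l · (X ⊗ Y))   ≡⟨ ·-· k l (X ⊗ Y) ⟩
  (k * l) · (X ⊗ Y)   ∎
  where open ≡-Reasoning

upper-⊗ : ∀ x y z x' y' z' →
          upper x y z ⊗ upper x' y' z' ≡ upper (x * x') (x * y' + y * z') (z * z')
upper-⊗ x y z x' y' z' = mat-cong
  (solve 3 (λ x y x' → x :* x' :+ y :* con 0ℚ := x :* x') refl x y x')
  refl
  (solve 3 (λ z x' y → con 0ℚ :* x' :+ z :* con 0ℚ := con 0ℚ) refl z x' y)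
  (solve 3 (λ z y' z' → con 0ℚ :* y' :+ z :* z' := z :* z') refl z y' z')

append-factor : ∀ k x y z l u v A B C →
  (k · upper x y z) ⊗ (l · upper u v 1ℚ) ⊗ upper A B C
  ≡ (k * l) · upper (x * u * A) (x * u * B + (x * v + y) * C) (z * C)
append-factor k x y z l u v A B C = begin
  (k · upper x y z) ⊗ (l · upper u v 1ℚ) ⊗ upper A B C
    ≡⟨ cong (_⊗ upper A B C) (scalar-⊗ k l (upper x y z) (upper u v 1ℚ)) ⟩
  ((k * l) · (upper x y z ⊗ upper u v 1ℚ)) ⊗ upper A B C
    ≡⟨ ·-⊗ (k * l) (upper x y z ⊗ upper u v 1ℚ) (upper A B C) ⟩
  (k * l) · (upper x y z ⊗ upper u v 1ℚ ⊗ upper A B C)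
    ≡⟨ cong (λ U → (k * l) · (U ⊗ upper A B C)) (upper-⊗ x y z u v 1ℚ) ⟩
  (k * l) · (upper (x * u) (x * v + y * 1ℚ) (z * 1ℚ) ⊗ upper A B C)
    ≡⟨ cong (λ e → (k * l) · (upper (x * u) (x * v + e) U' ⊗ upper A B C)) (QP.*-identityʳ y) ⟩
  (k * l) · (upper (x * u) (x * v + y) U' ⊗ upper A B C)
    ≡⟨ cong ((k * l) ·_) (upper-⊗ (x * u) (x * v + y) U' A B C) ⟩
  (k * l) · upper (x * u * A) (x * u * B + (x * v + y) * C) (U' * C)
    ≡⟨ cong (λ w → (k * l) · upper (x * u * A) (x * u * B + (x * v + y) * C) (w * C)) (QP.*-identityʳ z) ⟩
  (k * l) · upper (x * u * A) (x * u * B + (x * v + y) * C) (z * C) ∎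
  where
  open ≡-Reasoning
  U' = z * 1ℚ

^ᵣ-+ : ∀ r m n → r ^ᵣ (m ℕ.+ n) ≡ r ^ᵣ m * r ^ᵣ n
^ᵣ-+ r zero    n = sym (QP.*-identityˡ _)
^ᵣ-+ r (suc m) n = trans (cong (r *_) (^ᵣ-+ r m n)) (sym (QP.*-assoc r _ _))

valRev-++ : ∀ r xs ys → valRev r (xs ++ ys) ≡ valRev r xs + r ^ᵣ length xs * valRev r ys
valRev-++ r []       ys = sym (trans (QP.+-identityˡ _) (QP.*-identityˡ _))
valRev-++ r (x ∷ xs) ys = trans (cong (λ v → x + r * v) (valRev-++ r xs ys))
  (solve 5 (λ x r u p v → x :+ r :* (u :+ p :* v) := (x :+ r :* u) :+ r :* p :* v) refl
     x r (valRev r xs) (r ^ᵣ length xs) (valRev r ys))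

val-++ : ∀ r xs ys → val r (xs ++ ys) ≡ val r xs * r ^ᵣ length ys + val r ys
val-++ r xs ys = begin
  valRev r (reverse (xs ++ ys))
    ≡⟨ cong (valRev r) (LP.reverse-++ xs ys) ⟩
  valRev r (reverse ys ++ reverse xs)
    ≡⟨ valRev-++ r (reverse ys) (reverse xs) ⟩
  val r ys + r ^ᵣ length (reverse ys) * val r xs
    ≡⟨ cong (λ n → val r ys + r ^ᵣ n * val r xs) (LP.length-reverse ys) ⟩
  val r ys + r ^ᵣ length ys * val r xs
    ≡⟨ solve 3 (λ v p u → v :+ p :* u := u :* p :+ v) refl (val r ys) (r ^ᵣ length ys) (val r xs) ⟩
  val r xs * r ^ᵣ length ys + val r ys ∎
  where open ≡-Reasoning

val-∷ : ∀ r d ds → val r (d ∷ ds) ≡ d * r ^ᵣ length ds + val r ds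
val-∷ r d ds = trans (val-++ r [ d ] ds)
  (cong (λ e → e * r ^ᵣ length ds + val r ds)
    (solve 2 (λ d r → d :+ r :* con 0ℚ := d) refl d r))

val-scale : ∀ r k ds → val r (map (_* k) ds) ≡ val r ds * k
val-scale r k []       = sym (QP.*-zeroˡ k)
val-scale r k (d ∷ ds) = begin
  val r (d * k ∷ map (_* k) ds)
    ≡⟨ val-∷ r (d * k) (map (_* k) ds) ⟩
  d * k * r ^ᵣ length (map (_* k) ds) + val r (map (_* k) ds)
    ≡⟨ cong₂ (λ n v → d * k * r ^ᵣ n + v) (LP.length-map (_* k) ds) (val-scale r k ds) ⟩
  d * k * r ^ᵣ length ds + val r ds * k
    ≡⟨ solve 4 (λ d k p v → d :* k :* p :+ v :* k := (d :* p :+ v) :* k) refl d k (r ^ᵣ length ds) (val r ds) ⟩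
  (d * r ^ᵣ length ds + val r ds) * k
    ≡⟨ cong (_* k) (sym (val-∷ r d ds)) ⟩
  val r (d ∷ ds) * k ∎
  where open ≡-Reasoning

val-block : ∀ r d k e ds → val r (d ∷ (replicate k e ++ ds))
            ≡ d * (r ^ᵣ k * r ^ᵣ length ds) + (val r (replicate k e) * r ^ᵣ length ds + val r ds)
val-block r d k e ds = begin
  val r (d ∷ (replicate k e ++ ds))
    ≡⟨ val-∷ r d (replicate k e ++ ds) ⟩
  d * r ^ᵣ length (replicate k e ++ ds) + val r (replicate k e ++ ds)
    ≡⟨ cong₂ (λ n v → d * r ^ᵣ n + v) length-block (val-++ r (replicate k e) ds) ⟩
  d * r ^ᵣ (k ℕ.+ length ds) + (val r (replicate k e) * r ^ᵣ length ds + val r ds)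
    ≡⟨ cong (λ x → d * x + (val r (replicate k e) * r ^ᵣ length ds + val r ds)) (^ᵣ-+ r k (length ds)) ⟩
  d * (r ^ᵣ k * r ^ᵣ length ds) + (val r (replicate k e) * r ^ᵣ length ds + val r ds) ∎
  where
  open ≡-Reasoning
  length-block : length (replicate k e ++ ds) ≡ k ℕ.+ length ds
  length-block = trans (LP.length-++ (replicate k e)) (cong (ℕ._+ length ds) (LP.length-replicate k))

replicate-snoc : ∀ {X : Set} n (x : X) → replicate (suc n) x ≡ replicate n x ++ [ x ]
replicate-snoc zero    x = refl
replicate-snoc (suc n) x = cong (x ∷_) (replicate-snoc n x)

val-replicate-suc : ∀ r k d → val r (replicate (suc k) d) ≡ r * val r (replicate k d) + d
val-replicate-suc r k d = begin
  val r (replicate (suc k) d)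
    ≡⟨ cong (val r) (replicate-snoc k d) ⟩
  val r (replicate k d ++ [ d ])
    ≡⟨ val-++ r (replicate k d) [ d ] ⟩
  val r (replicate k d) * (r * 1ℚ) + (d + r * 0ℚ)
    ≡⟨ solve 3 (λ v r d → v :* (r :* con 1ℚ) :+ (d :+ r :* con 0ℚ) := r :* v :+ d) refl (val r (replicate k d)) r d ⟩
  r * val r (replicate k d) + d ∎
  where open ≡-Reasoning

M-power : ∀ a b c k →
          (c · upper a b 1ℚ) ^M k ≡ (c ^ᵣ k) · upper (a ^ᵣ k) (val a (replicate k b)) 1ℚ
M-power a b c zero    = mat-cong
  (sym (QP.*-identityˡ 1ℚ)) (sym (QP.*-zeroʳ 1ℚ)) (sym (QP.*-zeroʳ 1ℚ)) (sym (QP.*-identityˡ 1ℚ))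
M-power a b c (suc k) = begin
  (c · upper a b 1ℚ) ⊗ (c · upper a b 1ℚ) ^M k
    ≡⟨ cong ((c · upper a b 1ℚ) ⊗_) (M-power a b c k) ⟩
  (c · upper a b 1ℚ) ⊗ ((c ^ᵣ k) · upper (a ^ᵣ k) (val a (replicate k b)) 1ℚ)
    ≡⟨ scalar-⊗ c (c ^ᵣ k) _ _ ⟩
  (c ^ᵣ suc k) · (upper a b 1ℚ ⊗ upper (a ^ᵣ k) (val a (replicate k b)) 1ℚ)
    ≡⟨ cong ((c ^ᵣ suc k) ·_) (upper-⊗ a b 1ℚ (a ^ᵣ k) (val a (replicate k b)) 1ℚ) ⟩
  (c ^ᵣ suc k) · upper (a ^ᵣ suc k) (a * val a (replicate k b) + b * 1ℚ) (1ℚ * 1ℚ)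
    ≡⟨ cong (λ y → (c ^ᵣ suc k) · upper (a ^ᵣ suc k) y 1ℚ)
         (trans (cong (a * val a (replicate k b) +_) (QP.*-identityʳ b))
                (sym (val-replicate-suc a k b))) ⟩
  (c ^ᵣ suc k) · upper (a ^ᵣ suc k) (val a (replicate (suc k) b)) 1ℚ ∎
  where open ≡-Reasoning

-- chain is defined by peeling factors on the left; the induction appends on the right.
chain-peel : ∀ s M N m →
             chain (suc s) M N m ≡ chain s M (init N) (init m) ⊗ (M ^M last m) ⊗ last N
chain-peel zero    M N m = refl
chain-peel (suc s) M N m = begin
  X ⊗ chain (suc s) M (λ i → N (suc i)) (λ i → m (suc i))
    ≡⟨ cong (X ⊗_) (chain-peel s M (λ i → N (suc i)) (λ i → m (suc i))) ⟩
  X ⊗ (P ⊗ Q ⊗ R)       ≡⟨ ⊗-assoc X (P ⊗ Q) R ⟩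
  X ⊗ (P ⊗ Q) ⊗ R       ≡⟨ cong (_⊗ R) (⊗-assoc X P Q) ⟩
  X ⊗ P ⊗ Q ⊗ R         ∎
  where
  open ≡-Reasoning
  X = N zero ⊗ (M ^M m zero)
  P = chain s M (λ i → N (suc (inject₁ i))) (λ i → m (suc (inject₁ i)))
  Q = M ^M last m
  R = last N

sum-peel : ∀ s (m : Fin (suc s) → ℕ) → sumℕ (suc s) m ≡ sumℕ s (init m) ℕ.+ last m
sum-peel zero    m = ℕP.+-comm (m zero) 0
sum-peel (suc s) m = trans (cong (m zero ℕ.+_) (sum-peel s (λ i → m (suc i))))
  (sym (ℕP.+-assoc (m zero) _ _))

prod-peel : ∀ n (f : Fin (suc n) → ℚ) → prodℚ (suc n) f ≡ prodℚ n (init f) * last f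
prod-peel zero    f = trans (QP.*-identityʳ (f zero)) (sym (QP.*-identityˡ (f zero)))
prod-peel (suc n) f = trans (cong (f zero *_) (prod-peel n (λ i → f (suc i))))
  (sym (QP.*-assoc (f zero) _ _))

-- The word with its leading digit q₁ removed; qt lists the remaining q's.
wordTail : (s : ℕ) → (Fin s → ℚ) → (Fin s → ℚ) → (Fin s → ℕ) → List ℚ
wordTail zero    qt p m = []
wordTail (suc s) qt p m =
  replicate (last m ∸ 1) (p zero) ++ word s qt (λ i → p (suc i)) (init m)

word-unfold : ∀ s q p m → word s q p m ≡ q zero ∷ wordTail s (λ i → q (suc i)) p m
word-unfold zero    q p m = refl
word-unfold (suc s) q p m = refl

wordTail-scale : ∀ s qt p m k →
  wordTail s (λ i → qt i * k) (λ i → p i * k) m ≡ map (_* k) (wordTail s qt p m)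
wordTail-scale zero    qt p m k = refl
wordTail-scale (suc s) qt p m k = begin
  replicate n (p zero * k) ++ word s (λ i → qt i * k) (λ i → p (suc i) * k) (init m)
    ≡⟨ cong₂ _++_ (sym (LP.map-replicate (_* k) n (p zero)))
         (trans (word-unfold s (λ i → qt i * k) (λ i → p (suc i) * k) (init m))
                (cong (qt zero * k ∷_) (wordTail-scale s (λ i → qt (suc i)) (λ i → p (suc i)) (init m) k))) ⟩
  map (_* k) (replicate n (p zero)) ++ map (_* k) (qt zero ∷ T)
    ≡⟨ sym (LP.map-++ (_* k) (replicate n (p zero)) (qt zero ∷ T)) ⟩
  map (_* k) (replicate n (p zero) ++ (qt zero ∷ T))
    ≡⟨ cong (λ w → map (_* k) (replicate n (p zero) ++ w)) (sym (word-unfold s qt (λ i → p (suc i)) (init m))) ⟩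
  map (_* k) (replicate n (p zero) ++ word s qt (λ i → p (suc i)) (init m)) ∎
  where
  open ≡-Reasoning
  n = last m ∸ 1
  T = wordTail s (λ i → qt (suc i)) (λ i → p (suc i)) (init m)

length-wordTail : ∀ s qt p m → (∀ i → 1 ≤ m i) → length (wordTail s qt p m) ≡ sumℕ s m
length-wordTail zero    qt p m pos = refl
length-wordTail (suc s) qt p m pos = begin
  length (replicate (last m ∸ 1) (p zero) ++ word s qt (λ i → p (suc i)) (init m))
    ≡⟨ LP.length-++ (replicate (last m ∸ 1) (p zero)) ⟩
  length (replicate (last m ∸ 1) (p zero)) ℕ.+ length (word s qt (λ i → p (suc i)) (init m))
    ≡⟨ cong₂ ℕ._+_ (LP.length-replicate (last m ∸ 1))
         (cong length (word-unfold s qt (λ i → p (suc i)) (init m))) ⟩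
  (last m ∸ 1) ℕ.+ suc (length (wordTail s (λ i → qt (suc i)) (λ i → p (suc i)) (init m)))
    ≡⟨ cong (λ n → (last m ∸ 1) ℕ.+ suc n)
         (length-wordTail s (λ i → qt (suc i)) (λ i → p (suc i)) (init m) (λ i → pos (inject₁ i))) ⟩
  (last m ∸ 1) ℕ.+ suc (sumℕ s (init m))
    ≡⟨ ℕP.+-suc (last m ∸ 1) (sumℕ s (init m)) ⟩
  suc (last m ∸ 1) ℕ.+ sumℕ s (init m)
    ≡⟨ cong (ℕ._+ sumℕ s (init m)) (ℕP.suc-pred (last m) {{>-nonZero (pos (fromℕ s))}}) ⟩
  last m ℕ.+ sumℕ s (init m)
    ≡⟨ ℕP.+-comm (last m) (sumℕ s (init m)) ⟩
  sumℕ s (init m) ℕ.+ last m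
    ≡⟨ sym (sum-peel s m) ⟩
  sumℕ (suc s) m ∎
  where open ≡-Reasoning

length-word : ∀ s q p m → (∀ i → 1 ≤ m i) → length (word s q p m) ≡ suc (sumℕ s m)
length-word s q p m pos =
  trans (cong length (word-unfold s q p m)) (cong suc (length-wordTail s (λ i → q (suc i)) p m pos))

val-word : ∀ r s q p m → (∀ i → 1 ≤ m i) →
  val r (word s q p m) ≡ q zero * r ^ᵣ sumℕ s m + val r (wordTail s (λ i → q (suc i)) p m)
val-word r s q p m pos = begin
  val r (word s q p m)
    ≡⟨ cong (val r) (word-unfold s q p m) ⟩
  val r (q zero ∷ T)
    ≡⟨ val-∷ r (q zero) T ⟩
  q zero * r ^ᵣ length T + val r T
    ≡⟨ cong (λ n → q zero * r ^ᵣ n + val r T) (length-wordTail s (λ i → q (suc i)) p m pos) ⟩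
  q zero * r ^ᵣ sumℕ s m + val r T ∎
  where
  open ≡-Reasoning
  T = wordTail s (λ i → q (suc i)) p m

-- carry = b·A₁⋯A_s·C_{s+1}: the digit contributed by one M-factor followed by N_{s+1}.
carry : (s : ℕ) → ℚ → (A C : Fin (suc (suc s)) → ℚ) → ℚ
carry s b A C = b * (prodℚ (suc s) (init A) * last C)

-- The digits q₁ … q_{s+1} and p₁ … p_s (0-based), built by appending one
-- factor M^k N_{s+1} at a time: q₁ = A₁⋯A_s B_{s+1}, p₁ = carry, and the old
-- digits are multiplied by C_{s+1}, the old leading one absorbing the carry.
q-digits : (s : ℕ) → ℚ → (A B C : Fin (suc s) → ℚ) → Fin (suc s) → ℚ
q-digits zero    b A B C zero          = B zero
q-digits (suc s) b A B C zero          = prodℚ (suc s) (init A) * last B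
q-digits (suc s) b A B C (suc zero)    = q-digits s b (init A) (init B) (init C) zero * last C + carry s b A C
q-digits (suc s) b A B C (suc (suc i)) = q-digits s b (init A) (init B) (init C) (suc i) * last C

p-digits : (s : ℕ) → ℚ → (A B C : Fin (suc s) → ℚ) → Fin s → ℚ
p-digits (suc s) b A B C zero    = carry s b A C
p-digits (suc s) b A B C (suc i) = p-digits s b (init A) (init B) (init C) i * last C

-- Appending M^k N_{s+1} turns the value V of the old word into the
-- upper-right entry of [[x, V], [0, z]]·[[a^k, val_a(b^k)], [0, 1]]·N_{s+1},
-- where x = A₁⋯A_s a^S and S = m₁ + ⋯ + m_s.
val-word-step : ∀ s a b (A B C : Fin (suc (suc s)) → ℚ) m → (∀ i → 1 ≤ m i) →
  prodℚ (suc s) (init A) * a ^ᵣ sumℕ s (init m) * a ^ᵣ last m * last B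
    + (prodℚ (suc s) (init A) * a ^ᵣ sumℕ s (init m) * val a (replicate (last m) b)
       + val a (word s (q-digits s b (init A) (init B) (init C))
                       (p-digits s b (init A) (init B) (init C)) (init m))) * last C
  ≡ val a (word (suc s) (q-digits (suc s) b A B C) (p-digits (suc s) b A B C) m)
val-word-step s a b A B C m pos = begin
  PA * X * a ^ᵣ last m * Bl + (PA * X * val a (replicate (last m) b) + val a (word s q' p' m')) * Cl
    ≡⟨ cong₂ (λ n v → PA * X * a ^ᵣ n * Bl + (PA * X * val a (replicate n b) + v) * Cl)
         (sym k-suc) (val-word a s q' p' m' pos') ⟩
  PA * X * (a * Y) * Bl + (PA * X * val a (replicate (suc k) b) + (q' zero * X + vT)) * Cl
    ≡⟨ cong (λ g → PA * X * (a * Y) * Bl + (PA * X * g + (q' zero * X + vT)) * Cl)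
         (val-replicate-suc a k b) ⟩
  PA * X * (a * Y) * Bl + (PA * X * (a * G + b) + (q' zero * X + vT)) * Cl
    -- regroup by the new leading digit, the block p₁^k, and the rescaled old word
    ≡⟨ solve 10 (λ PA X a Y Bl G b q0 vT Cl →
         PA :* X :* (a :* Y) :* Bl :+ (PA :* X :* (a :* G :+ b) :+ (q0 :* X :+ vT)) :* Cl
         := (PA :* Bl) :* (Y :* (a :* X)) :+ (G :* (PA :* Cl) :* (a :* X) :+ ((q0 :* Cl :+ b :* (PA :* Cl)) :* X :+ vT :* Cl)))
         refl PA X a Y Bl G b (q' zero) vT Cl ⟩
  q zero * (Y * (a * X)) + (G * (PA * Cl) * (a * X) + (q (suc zero) * X + vT * Cl))
    ≡⟨ sym (cong₂ (λ e v → q zero * (Y * e) + (G * (PA * Cl) * e + v)) power-w₁ value-w₁) ⟩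
  q zero * (Y * a ^ᵣ length w₁) + (G * (PA * Cl) * a ^ᵣ length w₁ + val a w₁)
    ≡⟨ sym (cong (λ f → q zero * (Y * a ^ᵣ length w₁) + (f * a ^ᵣ length w₁ + val a w₁)) value-block) ⟩
  q zero * (Y * a ^ᵣ length w₁) + (val a (replicate k (p zero)) * a ^ᵣ length w₁ + val a w₁)
    ≡⟨ sym (val-block a (q zero) k (p zero) w₁) ⟩
  val a (word (suc s) q p m) ∎
  where
  open ≡-Reasoning
  q    = q-digits (suc s) b A B C
  p    = p-digits (suc s) b A B C
  q'   = q-digits s b (init A) (init B) (init C)
  p'   = p-digits s b (init A) (init B) (init C)
  m'   = init m
  pos' = λ i → pos (inject₁ i)
  PA   = prodℚ (suc s) (init A)
  Bl   = last B
  Cl   = last C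
  k    = last m ∸ 1
  X    = a ^ᵣ sumℕ s m'
  Y    = a ^ᵣ k
  G    = val a (replicate k b)
  -- the old tail, and the new word after its leading block q₁ p₁^k
  T    = wordTail s (λ i → q' (suc i)) p' m'
  vT   = val a T
  w₁   = word s (λ i → q (suc i)) (λ i → p (suc i)) m'
  k-suc : suc k ≡ last m
  k-suc = ℕP.suc-pred (last m) {{>-nonZero (pos (fromℕ s))}}
  power-w₁ : a ^ᵣ length w₁ ≡ a * X
  power-w₁ = cong (a ^ᵣ_) (length-word s (λ i → q (suc i)) (λ i → p (suc i)) m' pos')
  value-block : val a (replicate k (p zero)) ≡ G * (PA * Cl)
  value-block = trans (cong (val a) (sym (LP.map-replicate (_* (PA * Cl)) k b)))
                      (val-scale a (PA * Cl) (replicate k b))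
  -- w₁ is the old word rescaled by C_{s+1}, its leading digit plus the carry
  value-w₁ : val a w₁ ≡ q (suc zero) * X + vT * Cl
  value-w₁ = trans (val-word a s (λ i → q (suc i)) (λ i → p (suc i)) m' pos')
    (cong (q (suc zero) * X +_)
      (trans (cong (val a) (wordTail-scale s (λ i → q' (suc i)) p' m' Cl)) (val-scale a Cl T)))

-- The normal form, for every s ≥ 0,
-- with the explicit digits q-digits and p-digits.
chain-normal-form : ∀ s a b c (A B C : Fin (suc s) → ℚ) m → (∀ i → 1 ≤ m i) →
  chain s (c · upper a b 1ℚ) (λ i → upper (A i) (B i) (C i)) m
  ≡ (c ^ᵣ sumℕ s m) · upper (prodℚ (suc s) A * a ^ᵣ sumℕ s m)
                            (val a (word s (q-digits s b A B C) (p-digits s b A B C) m))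
                            (prodℚ (suc s) C)
chain-normal-form zero    a b c A B C m pos = mat-cong
  (solve 1 (λ x → x := con 1ℚ :* (x :* con 1ℚ :* con 1ℚ)) refl (A zero))
  (solve 2 (λ x a → x := con 1ℚ :* (x :+ a :* con 0ℚ)) refl (B zero) a)
  (sym (QP.*-zeroʳ 1ℚ))
  (solve 1 (λ x → x := con 1ℚ :* (x :* con 1ℚ)) refl (C zero))
chain-normal-form (suc s) a b c A B C m pos = begin
  chain (suc s) M N m
    ≡⟨ chain-peel s M N m ⟩
  chain s M (init N) (init m) ⊗ M ^M last m ⊗ last N
    ≡⟨ cong₂ (λ U P → U ⊗ P ⊗ last N)
         (chain-normal-form s a b c (init A) (init B) (init C) (init m) (λ i → pos (inject₁ i)))
         (M-power a b c (last m)) ⟩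
  ((c ^ᵣ S) · upper (PA * a ^ᵣ S) V PC) ⊗ ((c ^ᵣ last m) · upper (a ^ᵣ last m) G 1ℚ) ⊗ last N
    ≡⟨ append-factor (c ^ᵣ S) (PA * a ^ᵣ S) V PC (c ^ᵣ last m) (a ^ᵣ last m) G (last A) (last B) (last C) ⟩
  (c ^ᵣ S * c ^ᵣ last m) · upper (PA * a ^ᵣ S * a ^ᵣ last m * last A)
                                 (PA * a ^ᵣ S * a ^ᵣ last m * last B + (PA * a ^ᵣ S * G + V) * last C)
                                 (PC * last C)
    ≡⟨ ·upper-cong (split-power c) top-left (val-word-step s a b A B C m pos) (sym (prod-peel (suc s) C)) ⟩
  (c ^ᵣ sumℕ (suc s) m) · upper (prodℚ (suc (suc s)) A * a ^ᵣ sumℕ (suc s) m)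
                                (val a (word (suc s) (q-digits (suc s) b A B C) (p-digits (suc s) b A B C) m))
                                (prodℚ (suc (suc s)) C) ∎
  where
  open ≡-Reasoning
  M  = c · upper a b 1ℚ
  N  = λ i → upper (A i) (B i) (C i)
  S  = sumℕ s (init m)
  PA = prodℚ (suc s) (init A)
  PC = prodℚ (suc s) (init C)
  G  = val a (replicate (last m) b)
  V  = val a (word s (q-digits s b (init A) (init B) (init C)) (p-digits s b (init A) (init B) (init C)) (init m))
  split-power : ∀ r → r ^ᵣ S * r ^ᵣ last m ≡ r ^ᵣ sumℕ (suc s) m
  split-power r = sym (trans (cong (r ^ᵣ_) (sum-peel s m)) (^ᵣ-+ r S (last m)))
  top-left : PA * a ^ᵣ S * a ^ᵣ last m * last A ≡ prodℚ (suc (suc s)) A * a ^ᵣ sumℕ (suc s) m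
  top-left = begin
    PA * a ^ᵣ S * a ^ᵣ last m * last A
      ≡⟨ solve 4 (λ P x y z → P :* x :* y :* z := (P :* z) :* (x :* y)) refl PA (a ^ᵣ S) (a ^ᵣ last m) (last A) ⟩
    (PA * last A) * (a ^ᵣ S * a ^ᵣ last m)
      ≡⟨ cong₂ _*_ (sym (prod-peel (suc s) A)) (split-power a) ⟩
    prodℚ (suc (suc s)) A * a ^ᵣ sumℕ (suc s) m ∎

lemma2 : (s : ℕ) → 1 ≤ s → (a b c : ℚ) → (A B C : Fin (suc s) → ℚ) →
    Σ (Fin (suc s) → ℚ) λ q → Σ (Fin s → ℚ) λ p →
    (m : Fin s → ℕ) → (∀ i → 1 ≤ m i) →
    chain s (c · upper a b 1ℚ) (λ i → upper (A i) (B i) (C i)) m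
    ≡ (c ^ᵣ sumℕ s m) · upper (prodℚ (suc s) A * a ^ᵣ sumℕ s m)
    (val a (word s q p m))
    (prodℚ (suc s) C)
lemma2 s _ a b c A B C = q-digits s b A B C , p-digits s b A B C , chain-normal-form s a b c A B C
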